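{- Let $\mathcal{I}=(V,\mathcal{C},\kappa,\omega,k,W,U,\alpha)$ be an instance of Compressed Weighted MinCSP$(\{<,=,\neq\})$ and let $\mathcal{I}'=(V',\mathcal{C}',\kappa',\omega',k,W)$ be the Boolean instance constructed from it as described in the context. If $\mathcal{I}$ is a yes-instance of Compressed Weighted MinCSP$(\{<,=,\neq\})$, then $\mathcal{I}'$ is a yes-instance of Weighted Boolean MinCSP.
   Context: Compressed Weighted MinCSP$(\{<,=,\neq\})$: input is a satisfiable instance $(V,\mathcal{C})$ of CSP$(\{<,=,\neq\})$ (variables $V$, constraints of forms $x<y$, $x=y$, $x\neq y$ over $\mathbb{Q}$), functions $\kappa:\mathcal{C}\to\{1,\infty\}$, $\omega:\mathcal{C}\to\mathbb{Z}_+$, integers $k,W$, a subset $U\subseteq V$ with $|U|\le 2(k+1)$ and an injective $\alpha:U\to\mathbb{Q}$. It is a yes-instance if there is $X\subseteq\mathcal{C}$ with $\sum_{C\in X}\kappa(C)\le k$, $\sum_{C\in X}\omega(C)\le W$, and an assignment $\beta:V\to\mathbb{Q}$ satisfying all of $\mathcal{C}\setminus X$ that agrees with $\alpha$ (for all $x,y\in U$: $\beta(x)=\beta(y)$ iff $\alpha(x)=\alpha(y)$, and $\beta(x)<\beta(y)$ iff $\alpha(x)<\alpha(y)$). Weighted Boolean MinCSP: an instance $(V',\mathcal{C}',\kappa',\omega',k,W)$ consists of Boolean variables $V'$, constraints $\mathcal{C}'$ each given by a propositional formula over some of the variables (satisfied by a $\{0,1\}$-assignment iff the formula evaluates to true),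 $\kappa':\mathcal{C}'\to\{1,\infty\}$, $\omega':\mathcal{C}'\to\mathbb{Z}_+$; it is a yes-instance if there is $X'\subseteq\mathcal{C}'$ with $\sum_{C'\in X'}\kappa'(C')\le k$, $\sum_{C'\in X'}\omega'(C')\le W$ and $\mathcal{C}'\setminus X'$ satisfiable. Constraints with $\kappa'=\infty$ are called crisp. Construction of $\mathcal{I}'$: let $\ell=|U|$ and write $U=\{u_1,\dots,u_\ell\}$ with $\alpha(u_1)<\dots<\alpha(u_\ell)$. For each $v\in V$ introduce Boolean variables $c_{v,i}$ ($1\le i\le\ell$) and $p_{v,j}$ ($1\le j\le 2\ell+1$); $V'$ is the set of all these. Add the following crisp constraints: (a) $\neg c_{v,i}\lor\neg c_{v,i'}$ for all $v\in V$, $1\le i<i'\le\ell$; (b) $c_{u_i,i}=1$ for each $i$; (c) $p_{v,1}=1$ and $p_{v,j'}\to p_{v,j}$ for all $v\in V$, $1\le j<j'\le 2\ell+1$; (d) $p_{u_i,2i}=1$ and $p_{u_i,2i+1}=0$ for each $i$; (e) for all $v\in V$, $1\le i\le \ell$: $c_{v,i}\to p_{v,j}$ for $1\le j\le 2i$ and $c_{v,i}\to\neg p_{v,j}$ for $2i<j\le 2\ell+1$. Further, for each $C\in\mathcal{C}$ add a constraint $C'$ with $\kappa'(C')=\kappa(C)$, $\omega'(C')=\omega(C)$, defined as follows. If $C$ is $v=w$: $C'$ is the conjunction of $c_{v,i}\leftrightarrow c_{w,i}$ for all $i$, $p_{v,j}\leftrightarrow p_{w,j}$ for all $j$, together with all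 clauses of types (a), (c) (the implications $p_{v,j'}\to p_{v,j}$, $j<j'$) and (e) for the variable $v$. If $C$ is $v\neq w$: $C'$ is the conjunction of $\neg c_{v,i}\lor\neg c_{w,i}$ for all $1\le i\le\ell$, together with all clauses of type (a) for $v$. If $C$ is $v<w$: $C'$ is the conjunction of $p_{v,2i-1}\to p_{w,2i-1}$ and $p_{v,2i}\to p_{w,2i+1}$ for all $1\le i\le\ell$, together with all implications $p_{v,j'}\to p_{v,j}$ for $1\le j<j'\le 2\ell+1$. The parameters $k$ and $W$ are unchanged. -}

module Defs where

open import Data.Nat using (ℕ; zero; suc; _+_; _*_; _≤_; _<_; _<ᵇ_; _≤ᵇ_; s≤s; z≤n)
open import Data.Nat.Properties using (*-monoʳ-≤; ≤-trans; n≤1+n; +-suc; *-suc; +-comm; ≤-reflexive)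
open import Relation.Binary.PropositionalEquality using (trans)
open import Data.Fin using (Fin; toℕ; fromℕ<)
open import Data.Fin.Properties using (toℕ<n)
open import Data.Bool using (Bool; true; false; if_then_else_; _∧_; _∨_; not)
open import Data.List using (List; []; _∷_; _++_; concatMap; map; length; lookup; allFin)
open import Data.Product using (_×_; _,_; Σ; ∃; ∃-syntax; proj₁; proj₂)
open import Data.Rational using (ℚ) renaming (_<_ to _<ℚ_)
open import Function.Bundles using (_⇔_)
open import Relation.Binary.PropositionalEquality using (_≡_; _≢_; refl; cong)

data Kappa : Set where
  one : Kappa
  inf : Kappa

data ℕ∞ : Set where
  fin : ℕ → ℕ∞
  ∞   : ℕ∞

_+∞_ : ℕ∞ → ℕ∞ → ℕ∞
fin a +∞ fin b = fin (a + b)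
fin _ +∞ ∞     = ∞
∞     +∞ _     = ∞

data _≤∞_ : ℕ∞ → ℕ → Set where
  fin≤ : ∀ {a k} → a ≤ k → fin a ≤∞ k

kappaVal : Kappa → ℕ∞
kappaVal one = fin 1
kappaVal inf = ∞

sumℕ : (m : ℕ) → (Fin m → ℕ) → ℕ
sumℕ zero    f = 0
sumℕ (suc m) f = f Fin.zero + sumℕ m (λ i → f (Fin.suc i))

sumℕ∞ : (m : ℕ) → (Fin m → ℕ∞) → ℕ∞
sumℕ∞ zero    f = fin 0
sumℕ∞ (suc m) f = f Fin.zero +∞ sumℕ∞ m (λ i → f (Fin.suc i))

costκ : (m : ℕ) → (Fin m → Kappa) → (Fin m → Bool) → ℕ∞
costκ m κ X = sumℕ∞ m (λ c → if X c then kappaVal (κ c) else fin 0)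

costω : (m : ℕ) → (Fin m → ℕ) → (Fin m → Bool) → ℕ
costω m ω X = sumℕ m (λ c → if X c then ω c else 0)

data TCon (n : ℕ) : Set where
  lt  : Fin n → Fin n → TCon n
  eq  : Fin n → Fin n → TCon n
  neq : Fin n → Fin n → TCon n

SatT : ∀ {n} → (Fin n → ℚ) → TCon n → Set
SatT β (lt  x y) = β x <ℚ β y
SatT β (eq  x y) = β x ≡ β y
SatT β (neq x y) = β x ≢ β y

-- An instance of Compressed Weighted MinCSP({<,=,≠}).
-- U = {u_1,…,u_ℓ} is given by an injective enumeration u sorted by α,
-- i.e. α(u_1) < … < α(u_ℓ) (α is thereby injective).
record CInstance : Set where
  field
    n     : ℕ
    m     : ℕ
    con   : Fin m → TCon n
    κ     : Fin m → Kappa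
    ω     : Fin m → ℕ
    ω-pos : ∀ c → 1 ≤ ω c
    k     : ℕ
    W     : ℕ
    ℓ     : ℕ
    u     : Fin ℓ → Fin n
    u-inj : ∀ i j → u i ≡ u j → i ≡ j
    ℓ≤    : ℓ ≤ 2 * (k + 1)
    α     : Fin ℓ → ℚ
    α-sorted : ∀ i j → toℕ i < toℕ j → α i <ℚ α j
    satisfiable : ∃[ β ] (∀ c → SatT β (con c))

YesC : CInstance → Set
YesC I = ∃[ X ] ( (costκ m κ X ≤∞ k) × (costω m ω X ≤ W) ×
                  ∃[ β ] ( (∀ c → X c ≡ false → SatT β (con c)) ×
                           (∀ i j → (β (u i) ≡ β (u j)) ⇔ (α i ≡ α j)) ×
                           (∀ i j → (β (u i) <ℚ β (u j)) ⇔ (α i <ℚ α j)) ) )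
  where open CInstance I

data Formula (Var : Set) : Set where
  var   : Var → Formula Var
  ⊤f    : Formula Var
  ⊥f    : Formula Var
  ¬f_   : Formula Var → Formula Var
  _∧f_  : Formula Var → Formula Var → Formula Var
  _∨f_  : Formula Var → Formula Var → Formula Var
  _⇒f_  : Formula Var → Formula Var → Formula Var
  _⇔f_  : Formula Var → Formula Var → Formula Var

eval : ∀ {Var} → (Var → Bool) → Formula Var → Bool
eval σ (var x)  = σ x
eval σ ⊤f       = true
eval σ ⊥f       = false
eval σ (¬f φ)   = not (eval σ φ)
eval σ (φ ∧f ψ) = eval σ φ ∧ eval σ ψ
eval σ (φ ∨f ψ) = eval σ φ ∨ eval σ ψ
eval σ (φ ⇒f ψ) = not (eval σ φ) ∨ eval σ ψ
eval σ (φ ⇔f ψ) = (eval σ φ ∧ eval σ ψ) ∨ (not (eval σ φ) ∧ not (eval σ ψ))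

⋀ : ∀ {Var} → List (Formula Var) → Formula Var
⋀ []       = ⊤f
⋀ (φ ∷ φs) = φ ∧f ⋀ φs

record BInstance : Set₁ where
  field
    Var : Set
    m'  : ℕ
    con' : Fin m' → Formula Var
    κ'  : Fin m' → Kappa
    ω'  : Fin m' → ℕ
    k   : ℕ
    W   : ℕ

YesB : BInstance → Set
YesB J = ∃[ X ] ( (costκ m' κ' X ≤∞ k) × (costω m' ω' X ≤ W) ×
                  ∃[ σ ] (∀ c → X c ≡ false → eval σ (con' c) ≡ true) )
  where open BInstance J

-- Index conventions: c_{v,i} (1 ≤ i ≤ ℓ) is  c v i  with i : Fin ℓ,
-- toℕ i = i-1;  p_{v,j} (1 ≤ j ≤ 2ℓ+1) is  p v j  with
-- j : Fin (suc (2 * ℓ)), toℕ j = j-1.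

data BVar (n ℓ : ℕ) : Set where
  c : Fin n → Fin ℓ → BVar n ℓ
  p : Fin n → Fin (suc (2 * ℓ)) → BVar n ℓ

module Construction (I : CInstance) where
  open CInstance I

  F : Set
  F = Formula (BVar n ℓ)

  C : Fin n → Fin ℓ → F
  C v i = var (c v i)

  P : Fin n → Fin (suc (2 * ℓ)) → F
  P v j = var (p v j)

  private
    lem : (i : Fin ℓ) → 2 + 2 * toℕ i < suc (2 * ℓ)
    lem i = s≤s (≤-trans (≤-reflexive (sym' (*-suc 2 (toℕ i))))
                         (*-monoʳ-≤ 2 (toℕ<n i)))
      where
        sym' : ∀ {a b : ℕ} → a ≡ b → b ≡ a
        sym' refl = refl

  -- for i : Fin ℓ standing for the 1-based index i+1, the p-indices
  -- 2(i+1)-1, 2(i+1), 2(i+1)+1 (0-based: 2·toℕ i, 1+2·toℕ i, 2+2·toℕ i)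
  j2i-1 : Fin ℓ → Fin (suc (2 * ℓ))
  j2i-1 i = fromℕ< {2 * toℕ i} (≤-trans (n≤1+n _) (≤-trans (n≤1+n _) (lem i)))

  j2i : Fin ℓ → Fin (suc (2 * ℓ))
  j2i i = fromℕ< {1 + 2 * toℕ i} (≤-trans (n≤1+n _) (lem i))

  j2i+1 : Fin ℓ → Fin (suc (2 * ℓ))
  j2i+1 i = fromℕ< {2 + 2 * toℕ i} (lem i)

  Is : List (Fin ℓ)
  Is = allFin ℓ

  Js : List (Fin (suc (2 * ℓ)))
  Js = allFin (suc (2 * ℓ))

  Vs : List (Fin n)
  Vs = allFin n

  when : Bool → F → List F
  when b φ = if b then φ ∷ [] else []

  clausesA : Fin n → List F
  clausesA v = concatMap (λ i → concatMap (λ i' →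
                 when (toℕ i <ᵇ toℕ i') ((¬f C v i) ∨f (¬f C v i'))) Is) Is

  clausesB : List F
  clausesB = map (λ i → C (u i) i) Is

  clausesCimp : Fin n → List F
  clausesCimp v = concatMap (λ j → concatMap (λ j' →
                    when (toℕ j <ᵇ toℕ j') (P v j' ⇒f P v j)) Js) Js

  clausesC : Fin n → List F
  clausesC v = P v Fin.zero ∷ clausesCimp v

  clausesD : List F
  clausesD = concatMap (λ i → P (u i) (j2i i) ∷ (¬f P (u i) (j2i+1 i)) ∷ []) Is

  -- (e) for a fixed v: c_{v,i} → p_{v,j} for j ≤ 2i, c_{v,i} → ¬p_{v,j} for j > 2i
  -- (1-based j ≤ 2i  ⇔  toℕ j + 1 ≤ 2 (toℕ i + 1))
  clausesE : Fin n → List F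
  clausesE v = concatMap (λ i → concatMap (λ j →
                 if (toℕ j + 1) ≤ᵇ (2 * (toℕ i + 1))
                   then (C v i ⇒f P v j) ∷ []
                   else (C v i ⇒f (¬f P v j)) ∷ []) Js) Is

  crisp : List F
  crisp = concatMap clausesA Vs ++ clausesB ++ concatMap clausesC Vs
          ++ clausesD ++ concatMap clausesE Vs

  translate : TCon n → F
  translate (eq v w) =
    ⋀ (map (λ i → C v i ⇔f C w i) Is ++ map (λ j → P v j ⇔f P w j) Js
       ++ clausesA v ++ clausesCimp v ++ clausesE v)
  translate (neq v w) =
    ⋀ (map (λ i → (¬f C v i) ∨f (¬f C w i)) Is ++ clausesA v)
  translate (lt v w) =
    ⋀ (concatMap (λ i → (P v (j2i-1 i) ⇒f P w (j2i-1 i))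
                      ∷ (P v (j2i i) ⇒f P w (j2i+1 i)) ∷ []) Is
       ++ clausesCimp v)

  -- all constraints of 𝓘' with their κ', ω'
  -- (crisp constraints get κ' = ∞ and, arbitrarily, ω' = 1)
  allCons : List (F × Kappa × ℕ)
  allCons = map (λ φ → φ , inf , 1) crisp
            ++ map (λ e → translate (con e) , κ e , ω e) (allFin m)

  I' : BInstance
  I' = record
    { Var  = BVar n ℓ
    ; m'   = length allCons
    ; con' = λ e → proj₁ (lookup allCons e)
    ; κ'   = λ e → proj₁ (proj₂ (lookup allCons e))
    ; ω'   = λ e → proj₂ (proj₂ (lookup allCons e))
    ; k    = k
    ; W    = W
    }

construct : CInstance → BInstance
construct I = Construction.I' I

module Submission where

-- A solution (X, β) of 𝓘 yields a solution of 𝓘' with the same deletion set X.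
-- Because β agrees with α on U, the values b_i = β(u_i) are strictly increasing,
-- and they cut ℚ into the points b_i and the open intervals between them. The
-- Boolean assignment records where β(v) lies: c_{v,i} says β(v) = b_i, and the
-- thresholds p_{v,2i} and p_{v,2i+1} say β(v) ≥ b_i and β(v) > b_i. Sortedness
-- makes all crisp constraints true, and each constraint of 𝓘 satisfied by β
-- translates into a true formula. The crisp constraints are never deleted, so
-- both costs are those of X.

open import Defs
open import Data.Nat using (ℕ; zero; suc; _+_; _*_; _≤_; _<_; _≤ᵇ_; _<ᵇ_; _<?_; s≤s; s≤s⁻¹; s<s⁻¹)
open import Data.Nat.Properties
  using (*-suc; +-comm; *-monoʳ-≤; *-cancelˡ-≤; *-cancelˡ-<; <-≤-trans; m<1+n⇒m≤n
       ; m≤n⇒m<n∨m≡n; n≤1+n; ≤-trans; <⇒≤; ≤-reflexive; ≮⇒≥; <ᵇ⇒<; <⇒<ᵇ)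
open import Data.Fin using (Fin; toℕ)
open import Data.Fin.Properties using (toℕ-injective; toℕ-fromℕ<; toℕ<n; all?)
open import Data.Bool using (Bool; true; false; if_then_else_; _∨_; not; T)
open import Data.List using (List; []; _∷_; _++_; concatMap; map; length; lookup; allFin; tabulate)
open import Data.List.Properties using (map-++; map-∘; map-tabulate)
open import Data.List.Relation.Unary.All as All using (All; []; _∷_)
open import Data.List.Relation.Unary.All.Properties using (++⁺; map⁺; concat⁺; tabulate⁺)
open import Data.Sum using (inj₁; inj₂)
open import Data.Product using (_×_; _,_; proj₁; proj₂)
open import Data.Rational using (ℚ) renaming (_<_ to _<ℚ_; _≤_ to _≤ℚ_)
import Data.Rational.Properties as ℚ
open import Function using (_∘_; id)
open import Function.Bundles using (Equivalence)
open import Relation.Binary.PropositionalEquality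
open import Relation.Nullary using (Dec; yes; no; ¬_; contradiction)
open import Relation.Nullary.Decidable using (⌊_⌋; _×-dec_; _→-dec_)

_⊨_ : {Var : Set} → (Var → Bool) → Formula Var → Set
σ ⊨ φ = eval σ φ ≡ true

⊨-⋀ : {Var : Set} {σ : Var → Bool} {φs : List (Formula Var)} → All (σ ⊨_) φs → σ ⊨ ⋀ φs
⊨-⋀ []            = refl
⊨-⋀ (φ-true ∷ φs-true) rewrite φ-true = ⊨-⋀ φs-true

⊨-⇔f : {Var : Set} {σ : Var → Bool} (φ ψ : Formula Var) → eval σ φ ≡ eval σ ψ → σ ⊨ (φ ⇔f ψ)
⊨-⇔f {σ = σ} φ ψ same with eval σ φ | eval σ ψ
... | true  | true  = refl
... | false | false = refl

⌊⌋-true : {A : Set} (A? : Dec A) → A → ⌊ A? ⌋ ≡ true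
⌊⌋-true (yes _) _ = refl
⌊⌋-true (no ¬a) a = contradiction a ¬a

⌊⌋-not : {A : Set} (A? : Dec A) → ¬ A → not ⌊ A? ⌋ ≡ true
⌊⌋-not (yes a) ¬a = contradiction a ¬a
⌊⌋-not (no _)  _  = refl

⌊⌋-⇒ : {A B : Set} (A? : Dec A) (B? : Dec B) → (A → B) → not ⌊ A? ⌋ ∨ ⌊ B? ⌋ ≡ true
⌊⌋-⇒ (yes a) B? f = ⌊⌋-true B? (f a)
⌊⌋-⇒ (no _)  _  _ = refl

⌊⌋-nand : {A B : Set} (A? : Dec A) (B? : Dec B) → (A → ¬ B) → not ⌊ A? ⌋ ∨ not ⌊ B? ⌋ ≡ true
⌊⌋-nand (yes a) B? f = ⌊⌋-not B? (f a)
⌊⌋-nand (no _)  _  _ = refl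

All-if : {A : Set} {P : A → Set} (b : Bool) {xs ys : List A} →
         (T b → All P xs) → (¬ T b → All P ys) → All P (if b then xs else ys)
All-if true  xs-ok _     = xs-ok _
All-if false _     ys-ok = ys-ok λ ()

All-concatMap : {A B : Set} {P : B → Set} {f : A → List B} (xs : List A) →
                (∀ x → All P (f x)) → All P (concatMap f xs)
All-concatMap xs ok = concat⁺ (map⁺ (All.universal ok xs))

All-map : {A B : Set} {P : B → Set} {f : A → B} (xs : List A) →
          (∀ x → P (f x)) → All P (map f xs)
All-map xs ok = map⁺ (All.universal ok xs)

2*m<2+2*n⇒2*m<1+2*n : ∀ m n → 2 * m < 2 + 2 * n → 2 * m < suc (2 * n)
2*m<2+2*n⇒2*m<1+2*n m n h =
  s≤s (*-monoʳ-≤ 2 (s≤s⁻¹ (*-cancelˡ-< 2 m (suc n) (subst (2 * m <_) (sym (*-suc 2 n)) h))))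

m+1≤ᵇ2*[n+1]≡m<ᵇ2+2*n : ∀ m n → ((m + 1) ≤ᵇ (2 * (n + 1))) ≡ (m <ᵇ 2 + 2 * n)
m+1≤ᵇ2*[n+1]≡m<ᵇ2+2*n m n = cong₂ _≤ᵇ_ (+-comm m 1) (trans (cong (2 *_) (+-comm n 1)) (*-suc 2 n))

m+1≤ᵇ2*[n+1]⇒m≤1+2*n : ∀ m n → T ((m + 1) ≤ᵇ (2 * (n + 1))) → m ≤ suc (2 * n)
m+1≤ᵇ2*[n+1]⇒m≤1+2*n m n h = m<1+n⇒m≤n (<ᵇ⇒< m _ (subst T (m+1≤ᵇ2*[n+1]≡m<ᵇ2+2*n m n) h))

m+1≰ᵇ2*[n+1]⇒1+2*n<m : ∀ m n → ¬ T ((m + 1) ≤ᵇ (2 * (n + 1))) → suc (2 * n) < m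
m+1≰ᵇ2*[n+1]⇒1+2*n<m m n h = ≮⇒≥ (h ∘ subst T (sym (m+1≤ᵇ2*[n+1]≡m<ᵇ2+2*n m n)) ∘ <⇒<ᵇ)

+∞-identityˡ : ∀ x → fin 0 +∞ x ≡ x
+∞-identityˡ (fin _) = refl
+∞-identityˡ ∞       = refl

module WeightedList {Var : Set} (k W : ℕ) where

  WCon : Set
  WCon = Formula Var × Kappa × ℕ

  fromList : List WCon → BInstance
  fromList L = record
    { Var  = Var
    ; m'   = length L
    ; con' = λ e → proj₁ (lookup L e)
    ; κ'   = λ e → proj₁ (proj₂ (lookup L e))
    ; ω'   = λ e → proj₂ (proj₂ (lookup L e))
    ; k    = k
    ; W    = W
    }

  private
    Marked : Set
    Marked = WCon × Bool

    deletion : (L : List Marked) → Fin (length (map proj₁ L)) → Bool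
    deletion (x ∷ _) Fin.zero    = proj₂ x
    deletion (_ ∷ L) (Fin.suc e) = deletion L e

    κ-cost : List Marked → ℕ∞
    κ-cost L = costκ _ (λ e → proj₁ (proj₂ (lookup (map proj₁ L) e))) (deletion L)

    ω-cost : List Marked → ℕ
    ω-cost L = costω _ (λ e → proj₂ (proj₂ (lookup (map proj₁ L) e))) (deletion L)

    crisp : Formula Var → Marked
    crisp φ = (φ , inf , 1) , false

    κ-cost-crisp : ∀ hard L → κ-cost (map crisp hard ++ L) ≡ κ-cost L
    κ-cost-crisp []         L = refl
    κ-cost-crisp (_ ∷ hard) L = trans (+∞-identityˡ _) (κ-cost-crisp hard L)

    ω-cost-crisp : ∀ hard L → ω-cost (map crisp hard ++ L) ≡ ω-cost L
    ω-cost-crisp []         L = refl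
    ω-cost-crisp (_ ∷ hard) L = ω-cost-crisp hard L

    κ-cost-tabulate : ∀ {m} (soft : Fin m → WCon) (X : Fin m → Bool) →
                      κ-cost (tabulate (λ e → soft e , X e)) ≡ costκ m (proj₁ ∘ proj₂ ∘ soft) X
    κ-cost-tabulate {zero}  soft X = refl
    κ-cost-tabulate {suc m} soft X =
      cong ((if X Fin.zero then kappaVal (proj₁ (proj₂ (soft Fin.zero))) else fin 0) +∞_)
           (κ-cost-tabulate (soft ∘ Fin.suc) (X ∘ Fin.suc))

    ω-cost-tabulate : ∀ {m} (soft : Fin m → WCon) (X : Fin m → Bool) →
                      ω-cost (tabulate (λ e → soft e , X e)) ≡ costω m (proj₂ ∘ proj₂ ∘ soft) X
    ω-cost-tabulate {zero}  soft X = refl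
    ω-cost-tabulate {suc m} soft X =
      cong ((if X Fin.zero then proj₂ (proj₂ (soft Fin.zero)) else 0) +_)
           (ω-cost-tabulate (soft ∘ Fin.suc) (X ∘ Fin.suc))

    kept-satisfied : (σ : Var → Bool) (L : List Marked) →
                     All (λ x → proj₂ x ≡ false → σ ⊨ proj₁ (proj₁ x)) L →
                     ∀ e → deletion L e ≡ false → σ ⊨ proj₁ (lookup (map proj₁ L) e)
    kept-satisfied σ (_ ∷ _) (ok ∷ _)  Fin.zero    = ok
    kept-satisfied σ (_ ∷ L) (_ ∷ oks) (Fin.suc e) = kept-satisfied σ L oks e

  crisp++soft-yes : (hard : List (Formula Var)) {m : ℕ} (soft : Fin m → WCon) (X : Fin m → Bool) →
                    costκ m (proj₁ ∘ proj₂ ∘ soft) X ≤∞ k → costω m (proj₂ ∘ proj₂ ∘ soft) X ≤ W →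
                    (σ : Var → Bool) → All (σ ⊨_) hard → (∀ e → X e ≡ false → σ ⊨ proj₁ (soft e)) →
                    YesB (fromList (map (λ φ → φ , inf , 1) hard ++ map soft (allFin m)))
  crisp++soft-yes hard soft X κ-ok ω-ok σ hard-ok soft-ok =
    subst (YesB ∘ fromList) unmark
      ( deletion marked
      , subst (_≤∞ k) (sym (trans (κ-cost-crisp hard _) (κ-cost-tabulate soft X))) κ-ok
      , subst (_≤ W) (sym (trans (ω-cost-crisp hard _) (ω-cost-tabulate soft X))) ω-ok
      , σ
      , kept-satisfied σ marked (++⁺ (map⁺ (All.map (λ φ-ok _ → φ-ok) hard-ok)) (tabulate⁺ soft-ok)) )
    where
      marked : List Marked
      marked = map crisp hard ++ tabulate (λ e → soft e , X e)

      unmark : map proj₁ marked ≡ map (λ φ → φ , inf , 1) hard ++ map soft (allFin _)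
      unmark = trans (map-++ proj₁ (map crisp hard) _)
                     (cong₂ _++_ (sym (map-∘ hard))
                                 (trans (map-tabulate _ proj₁) (sym (map-tabulate id soft))))

module Encoding (I : CInstance) (β : Fin (CInstance.n I) → ℚ)
  (β-sorted : ∀ i j → toℕ i < toℕ j → β (CInstance.u I i) <ℚ β (CInstance.u I j)) where
  open CInstance I
  open Construction I

  b : Fin ℓ → ℚ
  b i = β (u i)

  b-mono : ∀ i j → toℕ i ≤ toℕ j → b i ≤ℚ b j
  b-mono i j i≤j with m≤n⇒m<n∨m≡n i≤j
  ... | inj₁ i<j = ℚ.<⇒≤ (β-sorted i j i<j)
  ... | inj₂ i≡j rewrite toℕ-injective i≡j = ℚ.≤-refl

  -- p_{v,j} with 0-based j is  Above (β v) j : β v passes the first j of the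
  -- cuts  b₀ ≤ ·, b₀ < ·, b₁ ≤ ·, b₁ < ·, … . Quantifying over all i (rather
  -- than only the last cut) makes monotonicity in j immediate.
  Above : ℚ → ℕ → Set
  Above q j = ∀ i → (2 * toℕ i < j → b i ≤ℚ q) × (suc (2 * toℕ i) < j → b i <ℚ q)

  Above? : ∀ q j → Dec (Above q j)
  Above? q j = all? λ i → ((2 * toℕ i <? j) →-dec (b i ℚ.≤? q))
                    ×-dec ((suc (2 * toℕ i) <? j) →-dec (b i ℚ.<? q))

  Above-zero : ∀ q → Above q 0
  Above-zero q i = (λ ()) , (λ ())

  Above-downward : ∀ {q j j'} → j ≤ j' → Above q j' → Above q j
  Above-downward j≤j' above i = (λ h → proj₁ (above i) (<-≤-trans h j≤j'))
                              , (λ h → proj₂ (above i) (<-≤-trans h j≤j'))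

  Above-upward : ∀ {q q' j} → q ≤ℚ q' → Above q j → Above q' j
  Above-upward q≤q' above i = (λ h → ℚ.≤-trans (proj₁ (above i) h) q≤q')
                            , (λ h → ℚ.<-≤-trans (proj₂ (above i) h) q≤q')

  Above-self : ∀ {i j} → j ≤ suc (2 * toℕ i) → Above (b i) j
  Above-self {i} j≤ i' = (λ h → b-mono i' i (*-cancelˡ-≤ 2 (m<1+n⇒m≤n (<-≤-trans h j≤))))
                       , (λ h → β-sorted i' i (*-cancelˡ-< 2 _ _ (s<s⁻¹ (<-≤-trans h j≤))))

  ¬Above-self : ∀ {i j} → suc (2 * toℕ i) < j → ¬ Above (b i) j
  ¬Above-self {i} i< above = ℚ.<-irrefl refl (proj₂ (above i) i<)

  Above-step : ∀ {q q' t} → q <ℚ q' → Above q (suc (2 * t)) → Above q' (2 + 2 * t)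
  Above-step {q} {q'} {t} q<q' above i =
      (λ h → ℚ.<⇒≤ (below (2*m<2+2*n⇒2*m<1+2*n (toℕ i) t h)))
    , (λ h → below (s<s⁻¹ h))
    where
      below : 2 * toℕ i < suc (2 * t) → b i <ℚ q'
      below h = ℚ.≤-<-trans (proj₁ (above i) h) q<q'

  σ : BVar n ℓ → Bool
  σ (c v i) = ⌊ β v ℚ.≟ b i ⌋
  σ (p v j) = ⌊ Above? (β v) (toℕ j) ⌋

  2+2*i<1+2*ℓ : ∀ (i : Fin ℓ) → 2 + 2 * toℕ i < suc (2 * ℓ)
  2+2*i<1+2*ℓ i = s≤s (subst (_≤ 2 * ℓ) (*-suc 2 (toℕ i)) (*-monoʳ-≤ 2 (toℕ<n i)))

  toℕ-j2i : ∀ i → toℕ (j2i i) ≡ suc (2 * toℕ i)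
  toℕ-j2i i = toℕ-fromℕ< (≤-trans (n≤1+n _) (2+2*i<1+2*ℓ i))

  toℕ-j2i+1 : ∀ i → toℕ (j2i+1 i) ≡ 2 + 2 * toℕ i
  toℕ-j2i+1 i = toℕ-fromℕ< (2+2*i<1+2*ℓ i)

  clausesA-true : ∀ v → All (σ ⊨_) (clausesA v)
  clausesA-true v = All-concatMap Is λ i → All-concatMap Is λ i' →
    All-if (toℕ i <ᵇ toℕ i')
      (λ i<i' → ⌊⌋-nand (β v ℚ.≟ b i) (β v ℚ.≟ b i')
                  (λ e e' → ℚ.<-irrefl (trans (sym e) e') (β-sorted i i' (<ᵇ⇒< _ _ i<i'))) ∷ [])
      (λ _ → [])

  clausesB-true : All (σ ⊨_) clausesB
  clausesB-true = All-map Is λ i → ⌊⌋-true (b i ℚ.≟ b i) refl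

  clausesCimp-true : ∀ v → All (σ ⊨_) (clausesCimp v)
  clausesCimp-true v = All-concatMap Js λ j → All-concatMap Js λ j' →
    All-if (toℕ j <ᵇ toℕ j')
      (λ j<j' → ⌊⌋-⇒ (Above? _ _) (Above? _ _) (Above-downward (<⇒≤ (<ᵇ⇒< _ _ j<j'))) ∷ [])
      (λ _ → [])

  clausesC-true : ∀ v → All (σ ⊨_) (clausesC v)
  clausesC-true v = ⌊⌋-true (Above? (β v) 0) (Above-zero (β v)) ∷ clausesCimp-true v

  clausesD-true : All (σ ⊨_) clausesD
  clausesD-true = All-concatMap Is λ i →
      ⌊⌋-true (Above? (b i) _) (Above-self (≤-reflexive (toℕ-j2i i)))
    ∷ ⌊⌋-not (Above? (b i) _) (¬Above-self (≤-reflexive (sym (toℕ-j2i+1 i))))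
    ∷ []

  clausesE-true : ∀ v → All (σ ⊨_) (clausesE v)
  clausesE-true v = All-concatMap Is λ i → All-concatMap Js λ j →
    All-if ((toℕ j + 1) ≤ᵇ (2 * (toℕ i + 1)))
      (λ j≤ → ⌊⌋-⇒ (β v ℚ.≟ b i) (Above? _ _)
                (λ β≡ → subst (λ q → Above q (toℕ j)) (sym β≡)
                          (Above-self (m+1≤ᵇ2*[n+1]⇒m≤1+2*n (toℕ j) (toℕ i) j≤))) ∷ [])
      (λ j≰ → ⌊⌋-nand (β v ℚ.≟ b i) (Above? _ _)
                (λ β≡ → subst (λ q → ¬ Above q (toℕ j)) (sym β≡)
                          (¬Above-self (m+1≰ᵇ2*[n+1]⇒1+2*n<m (toℕ j) (toℕ i) j≰))) ∷ [])

  crisp-true : All (σ ⊨_) crisp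
  crisp-true = ++⁺ (All-concatMap Vs clausesA-true)
              (++⁺ clausesB-true
              (++⁺ (All-concatMap Vs clausesC-true)
              (++⁺ clausesD-true
                   (All-concatMap Vs clausesE-true))))

  translate-true : ∀ t → SatT β t → σ ⊨ translate t
  translate-true (eq v w) β≡ = ⊨-⋀
    (++⁺ (All-map Is λ i → ⊨-⇔f {σ = σ} (C v i) (C w i) (cong (λ q → ⌊ q ℚ.≟ b i ⌋) β≡))
    (++⁺ (All-map Js λ j → ⊨-⇔f {σ = σ} (P v j) (P w j) (cong (λ q → ⌊ Above? q (toℕ j) ⌋) β≡))
    (++⁺ (clausesA-true v) (++⁺ (clausesCimp-true v) (clausesE-true v)))))
  translate-true (neq v w) β≢ = ⊨-⋀
    (++⁺ (All-map Is λ i → ⌊⌋-nand (β v ℚ.≟ b i) (β w ℚ.≟ b i) (λ e e' → β≢ (trans e (sym e'))))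
         (clausesA-true v))
  translate-true (lt v w) β< = ⊨-⋀
    (++⁺ (All-concatMap Is λ i →
            ⌊⌋-⇒ (Above? _ _) (Above? _ _) (Above-upward (ℚ.<⇒≤ β<))
          ∷ ⌊⌋-⇒ (Above? _ _) (Above? _ _)
              (λ above → subst (Above (β w)) (sym (toℕ-j2i+1 i))
                           (Above-step {t = toℕ i} β< (subst (Above (β v)) (toℕ-j2i i) above)))
          ∷ [])
         (clausesCimp-true v))

lemma6 : (I : CInstance) → YesC I → YesB (construct I)
lemma6 I (X , κ-ok , ω-ok , β , β-sat , _ , β-order) =
  crisp++soft-yes crisp (λ e → translate (con e) , κ e , ω e) X κ-ok ω-ok
                  σ crisp-true (λ e kept → translate-true (con e) (β-sat e kept))
  where
    open CInstance I
    open Construction I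
    open WeightedList k W
    open Encoding I β (λ i j → Equivalence.from (β-order i j) ∘ α-sorted i j)
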